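{- Let $q$ be a prime power, $n,r$ positive integers, and let $U_1,\ldots,U_r$ be $\mathbb{F}_q$-subspaces of $\mathbb{F}_{q^n}$ with $k_i=\dim_{\mathbb{F}_q}(U_i)\geq 2$ for every $i\in\{1,\ldots,r\}$. Let $\mathbf{e}_i\in\mathbb{F}_{q^n}^r$ denote the vector whose $i$-th entry is $1$ and all other entries are $0$. Then the following are equivalent: (i) the $\mathbb{F}_q$-subspace $U=U_1\times\cdots\times U_r$ of $\mathbb{F}_{q^n}^r$ satisfies (a) $\dim_{\mathbb{F}_q}(U\cap\langle\mathbf{v}\rangle_{\mathbb{F}_{q^n}})\leq 1$ for every $\mathbf{v}\in\mathbb{F}_{q^n}^r$ with $\langle\mathbf{v}\rangle_{\mathbb{F}_{q^n}}\notin\{\langle\mathbf{e}_i\rangle_{\mathbb{F}_{q^n}}: i\in\{1,\ldots,r\}\}$, and (b) $\dim_{\mathbb{F}_q}(U\cap\langle\mathbf{e}_i\rangle_{\mathbb{F}_{q^n}})=k_i\geq 2$ for every $i\in\{1,\ldots,r\}$; (ii) $U_i\cdot U_i^{ -1}\cap U_j\cdot U_j^{ -1}=\mathbb{F}_q$ for all $i\neq j$; (iii) $\dim_{\mathbb{F}_q}(U_i\cap\alpha U_j)\leq 1$ for every $\alpha\in\mathbb{F}_{q^n}$ and all $i,j\in\{1,\ldots,r\}$ with $i\neq j$.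
   Context: For $\mathbb{F}_q$-subspaces $U,V$ of $\mathbb{F}_{q^n}$: $U^{ -1}=\{u^{ -1}: u\in U\setminus\{0\}\}$, $U\cdot V=\{uv: u\in U, v\in V\}$, and $\alpha U=\{\alpha u: u\in U\}$. $\langle \mathbf{v}\rangle_{\mathbb{F}_{q^n}}$ is the $\mathbb{F}_{q^n}$-span of $\mathbf{v}$. -}

module Defs where

open import Level using (0ℓ)
open import Data.Nat using (ℕ; zero; suc; _≤_; _^_)
open import Data.Nat.Primality using (Prime)
open import Data.Fin using (Fin; zero; suc; _≟_)
open import Data.Vec using (Vec; zipWith; map; replicate; tabulate)
open import Data.Product using (Σ; ∃; ∃-syntax; _×_; _,_)
open import Relation.Binary.PropositionalEquality using (_≡_; _≢_)
open import Relation.Nullary using (yes; no; ¬_)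
open import Algebra.Core using (Op₁; Op₂)
open import Algebra.Structures using (IsCommutativeRing)
open import Function.Bundles using (_⇔_)

record Field : Set₁ where
  field
    Carrier : Set
    _+_ _*_ : Op₂ Carrier
    -_      : Op₁ Carrier
    0# 1#   : Carrier
    _⁻¹     : Op₁ Carrier
    isCommutativeRing : IsCommutativeRing _≡_ _+_ _*_ -_ 0# 1#
    0≢1     : 0# ≢ 1#
    ⁻¹-inverse : ∀ x → x ≢ 0# → x * (x ⁻¹) ≡ 1#
    0⁻¹≡0   : 0# ⁻¹ ≡ 0#
  infixl 6 _+_
  infixl 7 _*_

record IsFieldHom (K L : Field) (ι : Field.Carrier K → Field.Carrier L) : Set where
  private module K = Field K
  private module L = Field L
  field
    +-hom : ∀ x y → ι (x K.+ y) ≡ ι x L.+ ι y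
    *-hom : ∀ x y → ι (x K.* y) ≡ ι x L.* ι y
    0-hom : ι K.0# ≡ L.0#
    1-hom : ι K.1# ≡ L.1#

IsPrimePower : ℕ → Set
IsPrimePower q = ∃[ p ] ∃[ m ] (Prime p × 1 ≤ m × q ≡ p ^ m)

record VSpace (K : Field) : Set₁ where
  field
    V    : Set
    _⊕_  : Op₂ V
    𝟎    : V
    _•_  : Field.Carrier K → V → V

∑ : {A : Set} → Op₂ A → A → (m : ℕ) → (Fin m → A) → A
∑ _+_ z zero    f = z
∑ _+_ z (suc m) f = f zero + ∑ _+_ z m (λ i → f (suc i))

module _ {K : Field} (S : VSpace K) where
  open VSpace S
  private module K = Field K

  lincomb : (d : ℕ) → (Fin d → K.Carrier) → (Fin d → V) → V
  lincomb d c b = ∑ _⊕_ 𝟎 d (λ i → c i • b i)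

  IsSubspace : (V → Set) → Set
  IsSubspace W = W 𝟎 × (∀ x y → W x → W y → W (x ⊕ y))
                        × (∀ c x → W x → W (c • x))

  HasDim : (V → Set) → ℕ → Set
  HasDim W d = Σ (Fin d → V) λ b →
      (∀ i → W (b i))
    × (∀ c → lincomb d c b ≡ 𝟎 → ∀ i → c i ≡ K.0#)
    × (∀ x → W x → ∃[ c ] (x ≡ lincomb d c b))

  DimAtMost : (V → Set) → ℕ → Set
  DimAtMost W m = ∃[ d ] (d ≤ m × HasDim W d)

-- The field extension setting:  K = F_q  embedded in L = F_{q^n} via ι

module Ext (K L : Field) (ι : Field.Carrier K → Field.Carrier L) where
  private module K = Field K
  open Field L

  Lsp : VSpace K
  Lsp = record { V = Carrier ; _⊕_ = _+_ ; 𝟎 = 0# ; _•_ = λ c x → ι c * x }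

  Lrsp : ℕ → VSpace K
  Lrsp r = record { V = Vec Carrier r ; _⊕_ = zipWith _+_ ; 𝟎 = replicate r 0#
                  ; _•_ = λ c v → map (ι c *_) v }

  _∩_ : {A : Set} → (A → Set) → (A → Set) → A → Set
  (P ∩ Q) x = P x × Q x

  Fq : Carrier → Set
  Fq x = ∃[ c ] (x ≡ ι c)

  quotSet : (Carrier → Set) → Carrier → Set
  quotSet U x = ∃[ u ] ∃[ w ] (U u × U w × w ≢ 0# × x ≡ u * (w ⁻¹))

  scaleSet : Carrier → (Carrier → Set) → Carrier → Set
  scaleSet α U x = ∃[ u ] (U u × x ≡ α * u)

  span : {r : ℕ} → Vec Carrier r → Vec Carrier r → Set
  span v x = ∃[ λ' ] (x ≡ map (λ' *_) v)

  e : {r : ℕ} → Fin r → Vec Carrier r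
  e i = tabulate λ j → case (i ≟ j)
    where case : {P : Set} → Relation.Nullary.Dec P → Carrier
          case (yes _) = 1#
          case (no _)  = 0#

  prodSet : {r : ℕ} → (Fin r → Carrier → Set) → Vec Carrier r → Set
  prodSet {r} U x = ∀ i → U i (Data.Vec.lookup x i)

  _≐_ : {A : Set} → (A → Set) → (A → Set) → Set
  P ≐ Q = ∀ x → (P x ⇔ Q x)

  CondI : (r : ℕ) → (Fin r → Carrier → Set) → (Fin r → ℕ) → Set
  CondI r U k =
      (∀ (v : Vec Carrier r) → ¬ (∃[ i ] (span v ≐ span (e i)))
         → DimAtMost (Lrsp r) (prodSet U ∩ span v) 1)
    × (∀ i → HasDim (Lrsp r) (prodSet U ∩ span (e i)) (k i) × 2 ≤ k i)

  CondII : (r : ℕ) → (Fin r → Carrier → Set) → Set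
  CondII r U = ∀ (i j : Fin r) → i ≢ j → (quotSet (U i) ∩ quotSet (U j)) ≐ Fq

  CondIII : (r : ℕ) → (Fin r → Carrier → Set) → Set
  CondIII r U = ∀ (α : Carrier) (i j : Fin r) → i ≢ j
    → DimAtMost Lsp (U i ∩ scaleSet α (U j)) 1

-- Statements (ii) and (iii) both say, and (i) amounts to saying, that every U_i ∩ α U_j with i ≠ j is
-- collinear: each of its elements is an F_q-multiple of any nonzero one.  For (ii): x = α w′ and y = α w
-- give y / x = w / w′, a common quotient; conversely u / w = u′ / w′ puts u and w in U_i ∩ (w / w′) U_j.
-- For (i): x ↦ x (e_i + α⁻¹ e_j) embeds U_i ∩ α U_j into U ∩ ⟨e_i + α⁻¹ e_j⟩; conversely, if v_i and v_j
-- are nonzero for some i ≠ j, the i-th coordinate embeds U ∩ ⟨v⟩ into U_i ∩ (v_i / v_j) U_j, and any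
-- other v is 0 or spans some ⟨e_i⟩, where U ∩ ⟨e_i⟩ ≅ U_i.  Collinearity and the constructive
-- "dimension at most one" (which demands a basis) are interchangeable by exhaustive search, available
-- since F_q is finite and F_{q^n} has a finite F_q-basis.

module Submission where

open import Defs
open import Level using (0ℓ)
open import Algebra.Bundles using (CommutativeRing)
open import Algebra.Structures using (IsCommutativeRing)
import Algebra.Properties.CommutativeSemigroup as CommutativeSemigroupProperties
import Algebra.Properties.Group as GroupProperties
open import Data.Nat using (ℕ; zero; suc; _≤_; z≤n; s≤s)
open import Data.Nat.Properties using (<-≤-trans)
open import Data.Fin using (Fin; zero; suc; fromℕ<)
import Data.Fin.Properties as Fin
open import Data.Product using (∃; ∃₂; ∃-syntax; _×_; _,_; proj₁; proj₂)
open import Data.Sum using (_⊎_; inj₁; inj₂)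
open import Data.Unit using (⊤; tt)
open import Data.Vec using (Vec; []; _∷_; lookup; tabulate; map; zipWith; replicate)
open import Data.Vec.Properties
  using (lookup∘tabulate; tabulate∘lookup; tabulate-cong; lookup-map; lookup-zipWith; lookup-replicate;
         map-cong; map-id; map-∘; map-const; map-replicate; zipWith-replicate₂; ≡-dec)
open import Function using (_∘_; _∋_)
open import Function.Bundles using (_⇔_; _↔_; Inverse; Equivalence; mk⇔)
open import Function.Properties.Inverse using (↔-sym; ↔⇒↣)
open import Relation.Binary.Definitions using (DecidableEquality)
open import Relation.Binary.PropositionalEquality
open import Relation.Nullary using (Dec; yes; no; ¬_; contradiction)
open import Relation.Nullary.Decidable using (map′; decidable-stable; via-injection; ¬?; _×-dec_)
open import Relation.Unary using (Pred)
import Relation.Unary as Unary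

module FieldProperties (F : Field) where
  open Field F public
  open IsCommutativeRing isCommutativeRing public
    using (+-identityˡ; +-identityʳ; -‿inverseʳ; *-assoc; *-comm; *-identityˡ; *-identityʳ; zeroˡ; zeroʳ; distribʳ)
  open ≡-Reasoning

  private
    commutativeRing : CommutativeRing 0ℓ 0ℓ
    commutativeRing = record { isCommutativeRing = isCommutativeRing }
    open CommutativeRing commutativeRing using (+-group; *-commutativeSemigroup)

  open CommutativeSemigroupProperties *-commutativeSemigroup public using (interchange; x∙yz≈y∙xz; xy∙z≈zy∙x)
  open GroupProperties +-group public using () renaming (x∙y⁻¹≈ε⇒x≈y to x-y≡0⇒x≡y)

  infixl 7 _/_
  _/_ : Carrier → Carrier → Carrier
  x / y = x * y ⁻¹

  ⁻¹-inverseˡ : ∀ {x} → x ≢ 0# → x ⁻¹ * x ≡ 1#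
  ⁻¹-inverseˡ {x} x≢0 = trans (*-comm (x ⁻¹) x) (⁻¹-inverse x x≢0)

  *-cancelʳ : ∀ {x y z} → z ≢ 0# → x * z ≡ y * z → x ≡ y
  *-cancelʳ {x} {y} {z} z≢0 xz≡yz = begin
    x               ≡⟨ sym (*-identityʳ x) ⟩
    x * 1#          ≡⟨ cong (x *_) (sym (⁻¹-inverse z z≢0)) ⟩
    x * (z * z ⁻¹)  ≡⟨ sym (*-assoc x z (z ⁻¹)) ⟩
    x * z * z ⁻¹    ≡⟨ cong (_* z ⁻¹) xz≡yz ⟩
    y * z * z ⁻¹    ≡⟨ *-assoc y z (z ⁻¹) ⟩
    y * (z * z ⁻¹)  ≡⟨ cong (y *_) (⁻¹-inverse z z≢0) ⟩
    y * 1#          ≡⟨ *-identityʳ y ⟩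
    y               ∎

  x*y≡0⇒y≡0 : ∀ {x y} → x ≢ 0# → x * y ≡ 0# → y ≡ 0#
  x*y≡0⇒y≡0 {x} {y} x≢0 xy≡0 =
    *-cancelʳ x≢0 (trans (*-comm y x) (trans xy≡0 (sym (zeroˡ x))))

  *-nonzero : ∀ {x y} → x ≢ 0# → y ≢ 0# → x * y ≢ 0#
  *-nonzero x≢0 y≢0 = y≢0 ∘ x*y≡0⇒y≡0 x≢0

  ⁻¹-nonzero : ∀ {x} → x ≢ 0# → x ⁻¹ ≢ 0#
  ⁻¹-nonzero {x} x≢0 x⁻¹≡0 =
    0≢1 (trans (sym (zeroʳ x)) (trans (cong (x *_) (sym x⁻¹≡0)) (⁻¹-inverse x x≢0)))

  /*-cancel : ∀ {x y} → y ≢ 0# → x / y * y ≡ x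
  /*-cancel {x} {y} y≢0 = begin
    x * y ⁻¹ * y    ≡⟨ *-assoc x (y ⁻¹) y ⟩
    x * (y ⁻¹ * y)  ≡⟨ cong (x *_) (⁻¹-inverseˡ y≢0) ⟩
    x * 1#          ≡⟨ *-identityʳ x ⟩
    x               ∎

  */-cancel : ∀ {x y} → y ≢ 0# → x * y / y ≡ x
  */-cancel {x} {y} y≢0 = begin
    x * y * y ⁻¹    ≡⟨ *-assoc x y (y ⁻¹) ⟩
    x * (y * y ⁻¹)  ≡⟨ cong (x *_) (⁻¹-inverse y y≢0) ⟩
    x * 1#          ≡⟨ *-identityʳ x ⟩
    x               ∎

  ⁻¹-*-distrib : ∀ {x y} → x ≢ 0# → y ≢ 0# → (x * y) ⁻¹ ≡ x ⁻¹ * y ⁻¹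
  ⁻¹-*-distrib {x} {y} x≢0 y≢0 = *-cancelʳ (*-nonzero x≢0 y≢0) (begin
    (x * y) ⁻¹ * (x * y)          ≡⟨ ⁻¹-inverseˡ (*-nonzero x≢0 y≢0) ⟩
    1#                            ≡⟨ sym (*-identityˡ 1#) ⟩
    1# * 1#                       ≡⟨ sym (cong₂ _*_ (⁻¹-inverseˡ x≢0) (⁻¹-inverseˡ y≢0)) ⟩
    (x ⁻¹ * x) * (y ⁻¹ * y)       ≡⟨ interchange (x ⁻¹) x (y ⁻¹) y ⟩
    (x ⁻¹ * y ⁻¹) * (x * y)       ∎)

  *-/-cancelˡ : ∀ {x y z} → z ≢ 0# → y ≢ 0# → (z * x) / (z * y) ≡ x / y
  *-/-cancelˡ {x} {y} {z} z≢0 y≢0 = begin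
    (z * x) * (z * y) ⁻¹         ≡⟨ cong ((z * x) *_) (⁻¹-*-distrib z≢0 y≢0) ⟩
    (z * x) * (z ⁻¹ * y ⁻¹)      ≡⟨ interchange z x (z ⁻¹) (y ⁻¹) ⟩
    (z * z ⁻¹) * (x * y ⁻¹)      ≡⟨ cong (_* (x / y)) (⁻¹-inverse z z≢0) ⟩
    1# * (x * y ⁻¹)              ≡⟨ *-identityˡ (x / y) ⟩
    x / y                        ∎

  zero?⇒≟ : (∀ x → Dec (x ≡ 0#)) → DecidableEquality Carrier
  zero?⇒≟ zero? x y = map′ (x-y≡0⇒x≡y x y) (λ { refl → -‿inverseʳ x }) (zero? (x + - y))

Searchable : Set → Set₁
Searchable A = ∀ {P : Pred A 0ℓ} → Unary.Decidable P → Dec (∃ P)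

searchable-Fin : ∀ {n} → Searchable (Fin n)
searchable-Fin = Fin.any?

searchable-onto : ∀ {A B : Set} (f : A → B) → (∀ y → ∃[ x ] y ≡ f x) → Searchable A → Searchable B
searchable-onto f onto search {P} P? = map′
  (λ (x , p) → f x , p)
  (λ (y , p) → let (x , y≡fx) = onto y in x , subst P y≡fx p)
  (search (P? ∘ f))

searchable-Vec : ∀ {A : Set} {n} → Searchable A → Searchable (Vec A n)
searchable-Vec {n = zero}  search P? = map′ (λ p → [] , p) (λ { ([] , p) → p }) (P? [])
searchable-Vec {n = suc n} search P? = map′
  (λ (x , xs , p) → x ∷ xs , p)
  (λ { (x ∷ xs , p) → x , xs , p })
  (search λ x → searchable-Vec search (λ xs → P? (x ∷ xs)))

lookup-ext : ∀ {A : Set} {r} {u v : Vec A r} → (∀ j → lookup u j ≡ lookup v j) → u ≡ v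
lookup-ext {u = u} {v} u≗v = trans (sym (tabulate∘lookup u)) (trans (tabulate-cong u≗v) (tabulate∘lookup v))

module LinearCombination {K : Field} (S : VSpace K) where
  open VSpace S
  private module K = Field K

  lincomb-congˡ : ∀ {d} {c c′ : Fin d → K.Carrier} b → (∀ i → c i ≡ c′ i) →
                  lincomb S d c b ≡ lincomb S d c′ b
  lincomb-congˡ {zero}  b c≗c′ = refl
  lincomb-congˡ {suc d} b c≗c′ =
    cong₂ _⊕_ (cong (_• b zero) (c≗c′ zero)) (lincomb-congˡ (b ∘ suc) (c≗c′ ∘ suc))

  lincomb-congʳ : ∀ {d} c {b b′ : Fin d → V} → (∀ i → b i ≡ b′ i) → lincomb S d c b ≡ lincomb S d c b′
  lincomb-congʳ {zero}  c b≗b′ = refl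
  lincomb-congʳ {suc d} c b≗b′ =
    cong₂ _⊕_ (cong (c zero •_) (b≗b′ zero)) (lincomb-congʳ (c ∘ suc) (b≗b′ ∘ suc))

  lincomb-closed : ∀ {W d} → IsSubspace S W → ∀ c (b : Fin d → V) → (∀ i → W (b i)) → W (lincomb S d c b)
  lincomb-closed {d = zero}  (W𝟎 , _ , _) c b _ = W𝟎
  lincomb-closed {d = suc d} W-sub@(_ , W⊕ , W•) c b Wb =
    W⊕ _ _ (W• (c zero) (b zero) (Wb zero)) (lincomb-closed W-sub (c ∘ suc) (b ∘ suc) (Wb ∘ suc))

  -- coordinates stored in a vector, so that they range over a searchable type
  vector-coordinates : ∀ {W d} (basis : HasDim S W d) →
                       ∀ {x} → W x → ∃[ c ] x ≡ lincomb S d (lookup c) (proj₁ basis)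
  vector-coordinates (b , _ , _ , spans) {x} Wx =
    let (c , x≡) = spans x Wx in
    tabulate c , trans x≡ (lincomb-congˡ b (λ i → sym (lookup∘tabulate c i)))

  searchable-spanning : ∀ {d} → Searchable K.Carrier → HasDim S (λ _ → ⊤) d → Searchable V
  searchable-spanning searchK basis =
    searchable-onto _ (λ x → vector-coordinates basis tt) (searchable-Vec searchK)

  member? : ∀ {W d} → Searchable K.Carrier → DecidableEquality V →
            IsSubspace S W → HasDim S W d → Unary.Decidable W
  member? {W} {d} searchK _≟_ W-sub basis@(b , Wb , _) y = map′
    (λ (c , y≡) → subst W (sym y≡) (lincomb-closed W-sub (lookup c) b Wb))
    (vector-coordinates basis)
    (searchable-Vec searchK (λ c → y ≟ lincomb S d (lookup c) b))

  Collinear : (V → Set) → Set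
  Collinear W = ∀ {x y} → W x → W y → x ≢ 𝟎 → ∃[ a ] y ≡ a • x

  hasDim-0 : ∀ {W} → (∀ {x} → W x → x ≡ 𝟎) → HasDim S W 0
  hasDim-0 W≡𝟎 = (λ ()) , (λ ()) , (λ _ _ ()) , λ _ Wx → (λ ()) , W≡𝟎 Wx

  hasDim-map : ∀ {W d} {S′ : VSpace K} {W′ : VSpace.V S′ → Set} (f : V → VSpace.V S′) →
               (∀ c b → f (lincomb S d c b) ≡ lincomb S′ d c (f ∘ b)) →
               (∀ {x} → f x ≡ VSpace.𝟎 S′ → x ≡ 𝟎) →
               (∀ {x} → W x → W′ (f x)) →
               (∀ {y} → W′ y → ∃[ x ] W x × y ≡ f x) →
               HasDim S W d → HasDim S′ W′ d
  hasDim-map f f-linear f-kernel f-into f-onto (b , Wb , independent , spans) =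
    f ∘ b , f-into ∘ Wb ,
    (λ c combination≡𝟎 → independent c (f-kernel (trans (f-linear c b) combination≡𝟎))) ,
    λ y W′y → let (x , Wx , y≡fx) = f-onto W′y ; (c , x≡) = spans x Wx in
              c , trans y≡fx (trans (cong f x≡) (f-linear c b))

record VSpaceLaws {K : Field} (S : VSpace K) : Set where
  open VSpace S
  open Field K using (_*_; 0#; 1#)
  field
    ⊕-identityʳ : ∀ x → x ⊕ 𝟎 ≡ x
    •-assoc     : ∀ a b x → (a * b) • x ≡ a • (b • x)
    •-identityˡ : ∀ x → 1# • x ≡ x
    •-zeroˡ     : ∀ x → 0# • x ≡ 𝟎
    •-zeroʳ     : ∀ a → a • 𝟎 ≡ 𝟎

module Dimension {K : Field} (S : VSpace K) (laws : VSpaceLaws S) (_≟K_ : DecidableEquality (Field.Carrier K)) where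
  open VSpace S
  open VSpaceLaws laws
  open LinearCombination S
  private module K = FieldProperties K
  open ≡-Reasoning

  lincomb-𝟎 : ∀ {d} c (b : Fin d → V) → (∀ i → c i • b i ≡ 𝟎) → lincomb S d c b ≡ 𝟎
  lincomb-𝟎 {zero}  c b terms≡𝟎 = refl
  lincomb-𝟎 {suc d} c b terms≡𝟎 = begin
    (c zero • b zero) ⊕ lincomb S d (c ∘ suc) (b ∘ suc)
      ≡⟨ cong₂ _⊕_ (terms≡𝟎 zero) (lincomb-𝟎 (c ∘ suc) (b ∘ suc) (terms≡𝟎 ∘ suc)) ⟩
    𝟎 ⊕ 𝟎  ≡⟨ ⊕-identityʳ 𝟎 ⟩
    𝟎      ∎

  •≡𝟎⇒≡0 : ∀ {a x} → a • x ≡ 𝟎 → x ≢ 𝟎 → a ≡ K.0#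
  •≡𝟎⇒≡0 {a} {x} ax≡𝟎 x≢𝟎 with a ≟K K.0#
  ... | yes a≡0 = a≡0
  ... | no a≢0  = contradiction (begin
    x                    ≡⟨ sym (•-identityˡ x) ⟩
    K.1# • x             ≡⟨ cong (_• x) (sym (K.⁻¹-inverseˡ a≢0)) ⟩
    (a K.⁻¹ K.* a) • x   ≡⟨ •-assoc (a K.⁻¹) a x ⟩
    (a K.⁻¹) • (a • x)   ≡⟨ cong ((a K.⁻¹) •_) ax≡𝟎 ⟩
    (a K.⁻¹) • 𝟎         ≡⟨ •-zeroʳ (a K.⁻¹) ⟩
    𝟎                     ∎) x≢𝟎

  basis-nonzero : ∀ {W d} (basis : HasDim S W d) → ∀ m → proj₁ basis m ≢ 𝟎
  basis-nonzero {d = d} (b , _ , independent , _) m bm≡𝟎 =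
    K.0≢1 (trans (sym (independent indicator (lincomb-𝟎 indicator b term≡𝟎) m)) indicator-diagonal)
    where
    indicator : Fin d → K.Carrier
    indicator i with i Fin.≟ m
    ... | yes _ = K.1#
    ... | no _  = K.0#
    indicator-diagonal : indicator m ≡ K.1#
    indicator-diagonal with m Fin.≟ m
    ... | yes _   = refl
    ... | no m≢m  = contradiction refl m≢m
    term≡𝟎 : ∀ i → indicator i • b i ≡ 𝟎
    term≡𝟎 i with i Fin.≟ m
    ... | yes refl = trans (cong (K.1# •_) bm≡𝟎) (•-zeroʳ K.1#)
    ... | no _     = •-zeroˡ (b i)

  zero? : ∀ {d} → HasDim S (λ _ → ⊤) d → ∀ x → Dec (x ≡ 𝟎)
  zero? {d} (b , _ , independent , spans) x with spans x tt
  ... | c , x≡ = map′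
    (λ c≡0 → trans x≡ (lincomb-𝟎 c b (λ i → trans (cong (_• b i) (c≡0 i)) (•-zeroˡ (b i)))))
    (λ x≡𝟎 → independent c (trans (sym x≡) x≡𝟎))
    (Fin.all? (λ i → c i ≟K K.0#))

  hasDim-1 : ∀ {W x} → W x → x ≢ 𝟎 → (∀ {y} → W y → ∃[ a ] y ≡ a • x) → HasDim S W 1
  hasDim-1 {x = x} Wx x≢𝟎 multiple =
    (λ _ → x) , (λ _ → Wx) ,
    (λ { c cx≡𝟎 zero → •≡𝟎⇒≡0 (trans (sym (⊕-identityʳ _)) cx≡𝟎) x≢𝟎 }) ,
    λ y Wy → let (a , y≡) = multiple Wy in (λ _ → a) , trans y≡ (sym (⊕-identityʳ _))

  dimAtMost-1⇒collinear : ∀ {W} → DimAtMost S W 1 → Collinear W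
  dimAtMost-1⇒collinear (.0 , z≤n , _ , _ , _ , spans) {x} Wx _ x≢𝟎 =
    contradiction (proj₂ (spans x Wx)) x≢𝟎
  dimAtMost-1⇒collinear (.1 , s≤s z≤n , b , _ , _ , spans) {x} {y} Wx Wy x≢𝟎 =
    a′ K./ a , (begin
      y                       ≡⟨ y≡ ⟩
      (a′ • b zero) ⊕ 𝟎       ≡⟨ ⊕-identityʳ _ ⟩
      a′ • b zero             ≡⟨ cong (_• b zero) (sym (K./*-cancel a≢0)) ⟩
      (a′ K./ a K.* a) • b zero ≡⟨ •-assoc (a′ K./ a) a (b zero) ⟩
      (a′ K./ a) • (a • b zero) ≡⟨ cong ((a′ K./ a) •_) (sym x≡ab) ⟩
      (a′ K./ a) • x          ∎)
    where
    a  = proj₁ (spans x Wx) zero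
    a′ = proj₁ (spans y Wy) zero
    y≡ = proj₂ (spans y Wy)
    x≡ab : x ≡ a • b zero
    x≡ab = trans (proj₂ (spans x Wx)) (⊕-identityʳ _)
    a≢0 : a ≢ K.0#
    a≢0 a≡0 = x≢𝟎 (trans x≡ab (trans (cong (_• b zero) a≡0) (•-zeroˡ (b zero))))

  collinear⇒dimAtMost-1 : ∀ {W} → (∀ x → Dec (x ≡ 𝟎)) → Dec (∃[ x ] W x × x ≢ 𝟎) →
                          Collinear W → DimAtMost S W 1
  collinear⇒dimAtMost-1 _ (yes (x , Wx , x≢𝟎)) collinear =
    1 , s≤s z≤n , hasDim-1 Wx x≢𝟎 (λ Wy → collinear Wx Wy x≢𝟎)
  collinear⇒dimAtMost-1 zero? (no no-nonzero) _ =
    0 , z≤n , hasDim-0 λ {x} Wx → decidable-stable (zero? x) (λ x≢𝟎 → no-nonzero (x , Wx , x≢𝟎))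

module Extension (K L : Field) (ι : Field.Carrier K → Field.Carrier L) (hom : IsFieldHom K L ι) where
  open FieldProperties L
  open LinearCombination (Ext.Lsp K L ι) using (Collinear)
  open IsFieldHom hom
  open Ext K L ι
  open ≡-Reasoning

  Lsp-laws : VSpaceLaws Lsp
  Lsp-laws = record
    { ⊕-identityʳ = +-identityʳ
    ; •-assoc     = λ a b x → trans (cong (_* x) (*-hom a b)) (*-assoc (ι a) (ι b) x)
    ; •-identityˡ = λ x → trans (cong (_* x) 1-hom) (*-identityˡ x)
    ; •-zeroˡ     = λ x → trans (cong (_* x) 0-hom) (zeroˡ x)
    ; •-zeroʳ     = λ a → zeroʳ (ι a)
    }

  Lrsp-laws : ∀ r → VSpaceLaws (Lrsp r)
  Lrsp-laws r = record
    { ⊕-identityʳ = λ v → trans (zipWith-replicate₂ _+_ v 0#) (trans (map-cong +-identityʳ v) (map-id v))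
    ; •-assoc     = λ a b v → trans (map-cong (•-assoc a b) v) (map-∘ _ _ v)
    ; •-identityˡ = λ v → trans (map-cong •-identityˡ v) (map-id v)
    ; •-zeroˡ     = λ v → trans (map-cong •-zeroˡ v) (map-const v 0#)
    ; •-zeroʳ     = λ a → trans (map-replicate (ι a *_) 0# r) (cong (replicate r) (•-zeroʳ a))
    }
    where open VSpaceLaws Lsp-laws

  lookup-lincomb : ∀ {r d} c (B : Fin d → Vec Carrier r) j →
                   lookup (lincomb (Lrsp r) d c B) j ≡ lincomb Lsp d c (λ m → lookup (B m) j)
  lookup-lincomb {r} {zero}  c B j = lookup-replicate j 0#
  lookup-lincomb {r} {suc d} c B j = begin
    lookup (zipWith _+_ (map (ι (c zero) *_) (B zero)) (lincomb (Lrsp r) d (c ∘ suc) (B ∘ suc))) j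
      ≡⟨ lookup-zipWith _+_ j (map (ι (c zero) *_) (B zero)) (lincomb (Lrsp r) d (c ∘ suc) (B ∘ suc)) ⟩
    lookup (map (ι (c zero) *_) (B zero)) j + lookup (lincomb (Lrsp r) d (c ∘ suc) (B ∘ suc)) j
      ≡⟨ cong₂ _+_ (lookup-map j _ (B zero)) (lookup-lincomb (c ∘ suc) (B ∘ suc) j) ⟩
    ι (c zero) * lookup (B zero) j + lincomb Lsp d (c ∘ suc) (λ m → lookup (B (suc m)) j) ∎

  lincomb-*ʳ : ∀ {d} c (b : Fin d → Carrier) z → lincomb Lsp d c b * z ≡ lincomb Lsp d c (λ m → b m * z)
  lincomb-*ʳ {zero}  c b z = zeroˡ z
  lincomb-*ʳ {suc d} c b z = begin
    (ι (c zero) * b zero + lincomb Lsp d (c ∘ suc) (b ∘ suc)) * z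
      ≡⟨ distribʳ z _ _ ⟩
    ι (c zero) * b zero * z + lincomb Lsp d (c ∘ suc) (b ∘ suc) * z
      ≡⟨ cong₂ _+_ (*-assoc _ _ z) (lincomb-*ʳ (c ∘ suc) (b ∘ suc) z) ⟩
    ι (c zero) * (b zero * z) + lincomb Lsp d (c ∘ suc) (λ m → b (suc m) * z) ∎

  map-*-∘ : ∀ {r} a b (v : Vec Carrier r) → map (a *_) (map (b *_) v) ≡ map ((a * b) *_) v
  map-*-∘ a b v = trans (sym (map-∘ _ _ v)) (map-cong (λ x → sym (*-assoc a b x)) v)

  δ : {P : Set} → Dec P → Carrier
  δ (yes _) = 1#
  δ (no _)  = 0#

  -- The second `with` expression abstracts `i ≟ j` inside the hidden case split of `e`.
  lookup-e : ∀ {r} (i j : Fin r) → lookup (e i) j ≡ δ (i Fin.≟ j)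
  lookup-e i j with i Fin.≟ j | (lookup (e i) j ≡ _ ∋ lookup∘tabulate _ j)
  ... | yes _ | eᵢⱼ≡ = eᵢⱼ≡
  ... | no _  | eᵢⱼ≡ = eᵢⱼ≡

  lookup-e-diagonal : ∀ {r} (i : Fin r) → lookup (e i) i ≡ 1#
  lookup-e-diagonal i with i Fin.≟ i | lookup-e i i
  ... | yes _  | eᵢᵢ≡ = eᵢᵢ≡
  ... | no i≢i | _    = contradiction refl i≢i

  lookup-e-off : ∀ {r} {i j : Fin r} → i ≢ j → lookup (e i) j ≡ 0#
  lookup-e-off {i = i} {j} i≢j with i Fin.≟ j | lookup-e i j
  ... | yes i≡j | _    = contradiction i≡j i≢j
  ... | no _    | eᵢⱼ≡ = eᵢⱼ≡

  lincomb-map-* : ∀ {r d} c (b : Fin d → Carrier) (w : Vec Carrier r) →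
                  map (lincomb Lsp d c b *_) w ≡ lincomb (Lrsp r) d c (λ m → map (b m *_) w)
  lincomb-map-* {r} {d} c b w = lookup-ext λ j → begin
    lookup (map (lincomb Lsp d c b *_) w) j             ≡⟨ lookup-map j _ w ⟩
    lincomb Lsp d c b * lookup w j                      ≡⟨ lincomb-*ʳ c b (lookup w j) ⟩
    lincomb Lsp d c (λ m → b m * lookup w j)            ≡⟨ lincomb-congʳ c (λ m → sym (lookup-map j _ w)) ⟩
    lincomb Lsp d c (λ m → lookup (map (b m *_) w) j)   ≡⟨ sym (lookup-lincomb c _ j) ⟩
    lookup (lincomb (Lrsp r) d c (λ m → map (b m *_) w)) j ∎
    where open LinearCombination Lsp using (lincomb-congʳ)

  lookup-scaled-e-diagonal : ∀ {r} (i : Fin r) x → lookup (map (x *_) (e i)) i ≡ x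
  lookup-scaled-e-diagonal i x =
    trans (lookup-map i (x *_) (e i)) (trans (cong (x *_) (lookup-e-diagonal i)) (*-identityʳ x))

  span-e-off : ∀ {r x} {l m : Fin r} → span (e l) x → l ≢ m → lookup x m ≡ 0#
  span-e-off {x = x} {l} {m} (μ , x≡) l≢m = begin
    lookup x m                  ≡⟨ cong (λ w → lookup w m) x≡ ⟩
    lookup (map (μ *_) (e l)) m ≡⟨ lookup-map m (μ *_) (e l) ⟩
    μ * lookup (e l) m          ≡⟨ cong (μ *_) (lookup-e-off l≢m) ⟩
    μ * 0#                      ≡⟨ zeroʳ μ ⟩
    0#                          ∎

  span-self : ∀ {r} (v : Vec Carrier r) → span v v
  span-self v = 1# , sym (trans (map-cong *-identityˡ v) (map-id v))

  span-scale : ∀ {r} {μ} (w : Vec Carrier r) → μ ≢ 0# → span (map (μ *_) w) ≐ span w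
  span-scale {μ = μ} w μ≢0 x = mk⇔
    (λ (ν , x≡) → ν * μ , trans x≡ (map-*-∘ ν μ w))
    (λ (ν , x≡) → ν / μ , (begin
       x                               ≡⟨ x≡ ⟩
       map (ν *_) w                    ≡⟨ cong (λ a → map (a *_) w) (sym (/*-cancel μ≢0)) ⟩
       map ((ν / μ * μ) *_) w          ≡⟨ sym (map-*-∘ (ν / μ) μ w) ⟩
       map ((ν / μ) *_) (map (μ *_) w) ∎))

  span-𝟎 : ∀ {r x} → span (replicate r 0#) x → x ≡ replicate r 0#
  span-𝟎 {r} (μ , x≡) = trans x≡ (trans (map-replicate (μ *_) 0# r) (cong (replicate r) (zeroʳ μ)))

  span-axis : ∀ {r} {v : Vec Carrier r} {i} → lookup v i ≢ 0# → (∀ {j} → i ≢ j → lookup v j ≡ 0#) →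
              span v ≐ span (e i)
  span-axis {v = v} {i} vᵢ≢0 off-axis = subst (λ w → span w ≐ span (e i)) (sym v≡) (span-scale (e i) vᵢ≢0)
    where
    coordinate : ∀ j → lookup v i * lookup (e i) j ≡ lookup v j
    coordinate j with i Fin.≟ j
    ... | yes refl = trans (cong (lookup v i *_) (lookup-e-diagonal i)) (*-identityʳ _)
    ... | no i≢j   = trans (cong (lookup v i *_) (lookup-e-off i≢j)) (trans (zeroʳ _) (sym (off-axis i≢j)))
    v≡ : v ≡ map (lookup v i *_) (e i)
    v≡ = lookup-ext λ j → sym (trans (lookup-map j _ (e i)) (coordinate j))

  e+βe : ∀ {r} → Fin r → Carrier → Fin r → Vec Carrier r
  e+βe i β j = zipWith _+_ (e i) (map (β *_) (e j))

  module _ {r} {i j : Fin r} (i≢j : i ≢ j) (β : Carrier) where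
    private
      lookup-e+βe : ∀ m → lookup (e+βe i β j) m ≡ lookup (e i) m + β * lookup (e j) m
      lookup-e+βe m = trans (lookup-zipWith _+_ m (e i) _) (cong (lookup (e i) m +_) (lookup-map m (β *_) (e j)))

    e+βe-at-i : lookup (e+βe i β j) i ≡ 1#
    e+βe-at-i = begin
      lookup (e+βe i β j) i                 ≡⟨ lookup-e+βe i ⟩
      lookup (e i) i + β * lookup (e j) i   ≡⟨ cong₂ (λ a b → a + β * b) (lookup-e-diagonal i) (lookup-e-off (i≢j ∘ sym)) ⟩
      1# + β * 0#                           ≡⟨ cong (1# +_) (zeroʳ β) ⟩
      1# + 0#                               ≡⟨ +-identityʳ 1# ⟩
      1#                                    ∎

    e+βe-at-j : lookup (e+βe i β j) j ≡ β
    e+βe-at-j = begin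
      lookup (e+βe i β j) j                 ≡⟨ lookup-e+βe j ⟩
      lookup (e i) j + β * lookup (e j) j   ≡⟨ cong₂ (λ a b → a + β * b) (lookup-e-off i≢j) (lookup-e-diagonal j) ⟩
      0# + β * 1#                           ≡⟨ +-identityˡ (β * 1#) ⟩
      β * 1#                                ≡⟨ *-identityʳ β ⟩
      β                                     ∎

    e+βe-elsewhere : ∀ {m} → i ≢ m → j ≢ m → lookup (e+βe i β j) m ≡ 0#
    e+βe-elsewhere {m} i≢m j≢m = begin
      lookup (e+βe i β j) m                 ≡⟨ lookup-e+βe m ⟩
      lookup (e i) m + β * lookup (e j) m   ≡⟨ cong₂ (λ a b → a + β * b) (lookup-e-off i≢m) (lookup-e-off j≢m) ⟩
      0# + β * 0#                           ≡⟨ +-identityˡ (β * 0#) ⟩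
      β * 0#                                ≡⟨ zeroʳ β ⟩
      0#                                    ∎

  e+βe-nonaxial : ∀ {r} {i j : Fin r} {β} → i ≢ j → β ≢ 0# → ¬ (∃[ l ] span (e+βe i β j) ≐ span (e l))
  e+βe-nonaxial {i = i} {j} {β} i≢j β≢0 (l , ⟨v⟩≐⟨eₗ⟩) with Equivalence.to (⟨v⟩≐⟨eₗ⟩ _) (span-self _) | l Fin.≟ i
  ... | v∈⟨eₗ⟩ | yes refl = β≢0 (trans (sym (e+βe-at-j i≢j β)) (span-e-off v∈⟨eₗ⟩ i≢j))
  ... | v∈⟨eₗ⟩ | no l≢i   = 0≢1 (sym (trans (sym (e+βe-at-i i≢j β)) (span-e-off v∈⟨eₗ⟩ l≢i)))

  Fq⊆quotSet : ∀ {U} → IsSubspace Lsp U → (∃[ u ] U u × u ≢ 0#) → ∀ {x} → Fq x → quotSet U x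
  Fq⊆quotSet (_ , _ , U•) (u , Uu , u≢0) (a , x≡) =
    ι a * u , u , U• a u Uu , Uu , u≢0 , trans x≡ (sym (*/-cancel u≢0))

  quotients-in-Fq⇒collinear : ∀ {U U′} → (∀ {x} → (quotSet U ∩ quotSet U′) x → Fq x) →
                              ∀ α → Collinear (U ∩ scaleSet α U′)
  quotients-in-Fq⇒collinear quotients-in-Fq α {x} {y} (Ux , w′ , U′w′ , x≡αw′) (Uy , w , U′w , y≡αw) x≢0 =
    let (a , y/x≡) = quotients-in-Fq ((y , x , Uy , Ux , x≢0 , refl) , (w , w′ , U′w , U′w′ , w′≢0 , y/x≡w/w′))
    in a , trans (sym (/*-cancel x≢0)) (cong (_* x) y/x≡)
    where
    α≢0 : α ≢ 0#
    α≢0 α≡0 = x≢0 (trans x≡αw′ (trans (cong (_* w′) α≡0) (zeroˡ w′)))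
    w′≢0 : w′ ≢ 0#
    w′≢0 w′≡0 = x≢0 (trans x≡αw′ (trans (cong (α *_) w′≡0) (zeroʳ α)))
    y/x≡w/w′ : y / x ≡ w / w′
    y/x≡w/w′ = trans (cong₂ _/_ y≡αw x≡αw′) (*-/-cancelˡ α≢0 w′≢0)

  collinear⇒quotients-in-Fq : ∀ {U U′} → (∀ α → Collinear (U ∩ scaleSet α U′)) →
                              ∀ {x} → (quotSet U ∩ quotSet U′) x → Fq x
  collinear⇒quotients-in-Fq collinear {x} ((u , w , Uu , Uw , w≢0 , x≡u/w) , (u′ , w′ , U′u′ , U′w′ , w′≢0 , x≡u′/w′)) =
    let (a , u≡aw) = collinear (w / w′) (Uw , w′ , U′w′ , sym (/*-cancel w′≢0)) (Uu , u′ , U′u′ , u≡) w≢0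
    in a , trans x≡u/w (trans (cong (_/ w) u≡aw) (*/-cancel w≢0))
    where
    u≡ : u ≡ w / w′ * u′
    u≡ = begin
      u                 ≡⟨ sym (/*-cancel w≢0) ⟩
      u / w * w         ≡⟨ cong (_* w) (trans (sym x≡u/w) x≡u′/w′) ⟩
      u′ * w′ ⁻¹ * w    ≡⟨ xy∙z≈zy∙x u′ (w′ ⁻¹) w ⟩
      w * w′ ⁻¹ * u′    ∎

module FiniteExtension (K L : Field) (ι : Field.Carrier K → Field.Carrier L) (hom : IsFieldHom K L ι)
                       {q} (finite : Fin q ↔ Field.Carrier K)
                       {n} (basis : HasDim (Ext.Lsp K L ι) (λ _ → ⊤) n) where
  open FieldProperties L
  open Ext K L ι
  open Extension K L ι hom
  private module K = Field K

  _≟K_ : DecidableEquality K.Carrier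
  _≟K_ = via-injection (↔⇒↣ (↔-sym finite)) Fin._≟_

  searchable-K : Searchable K.Carrier
  searchable-K = searchable-onto (Inverse.to finite)
    (λ a → Inverse.from finite a , sym (Inverse.strictlyInverseˡ finite a)) searchable-Fin

  module Lᴷ = Dimension Lsp Lsp-laws _≟K_
  module Lʳᴷ r = Dimension (Lrsp r) (Lrsp-laws r) _≟K_

  searchable-L : Searchable Carrier
  searchable-L = LinearCombination.searchable-spanning Lsp searchable-K basis

  zero? : ∀ x → Dec (x ≡ 0#)
  zero? = Lᴷ.zero? basis

  infix 4 _≟_ _≟ᵛ_
  _≟_ : DecidableEquality Carrier
  _≟_ = zero?⇒≟ zero?

  _≟ᵛ_ : ∀ {r} → DecidableEquality (Vec Carrier r)
  _≟ᵛ_ = ≡-dec _≟_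

  scaleSet? : ∀ {U} → Unary.Decidable U → ∀ α → Unary.Decidable (scaleSet α U)
  scaleSet? U? α x = searchable-L (λ u → U? u ×-dec x ≟ α * u)

  span? : ∀ {r} (v : Vec Carrier r) → Unary.Decidable (span v)
  span? v x = searchable-L (λ μ → x ≟ᵛ map (μ *_) v)

  𝟎-or-axis-or-two-nonzero : ∀ {r} (v : Vec Carrier r) →
    v ≡ replicate r 0# ⊎ (∃[ i ] span v ≐ span (e i)) ⊎ (∃₂ λ i j → i ≢ j × lookup v i ≢ 0# × lookup v j ≢ 0#)
  𝟎-or-axis-or-two-nonzero {r} v with Fin.any? (λ i → ¬? (zero? (lookup v i)))
  ... | no all-zero = inj₁ (lookup-ext λ j →
        trans (decidable-stable (zero? _) (λ vⱼ≢0 → all-zero (j , vⱼ≢0))) (sym (lookup-replicate j 0#)))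
  ... | yes (i , vᵢ≢0) with Fin.any? (λ j → ¬? (i Fin.≟ j) ×-dec ¬? (zero? (lookup v j)))
  ...   | yes (j , i≢j , vⱼ≢0) = inj₂ (inj₂ (i , j , i≢j , vᵢ≢0 , vⱼ≢0))
  ...   | no none = inj₂ (inj₁ (i , span-axis vᵢ≢0 λ {j} i≢j →
          decidable-stable (zero? _) (λ vⱼ≢0 → none (j , i≢j , vⱼ≢0))))

  module Conditions {r} (U : Fin r → Carrier → Set) (U-sub : ∀ i → IsSubspace Lsp (U i))
                    {k : Fin r → ℕ} (bases : ∀ i → HasDim Lsp (U i) (k i)) (k≥2 : ∀ i → 2 ≤ k i) where
    open LinearCombination using (Collinear)
    open ≡-Reasoning

    U? : ∀ i → Unary.Decidable (U i)
    U? i = LinearCombination.member? Lsp searchable-K _≟_ (U-sub i) (bases i)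

    prodSet? : Unary.Decidable (prodSet U)
    prodSet? x = Fin.all? (λ i → U? i (lookup x i))

    nonzero-element : ∀ i → ∃[ u ] U i u × u ≢ 0#
    nonzero-element i = b i₀ , Ub i₀ , Lᴷ.basis-nonzero (bases i) i₀
      where
      b  = proj₁ (bases i)
      Ub = proj₁ (proj₂ (bases i))
      i₀ = fromℕ< (<-≤-trans (s≤s z≤n) (k≥2 i))

    CollinearIntersections : Set
    CollinearIntersections = ∀ α {i j} → i ≢ j → Collinear Lsp (U i ∩ scaleSet α (U j))

    condIII⇔collinear : CondIII r U ⇔ CollinearIntersections
    condIII⇔collinear = mk⇔ to from
      where
      to : CondIII r U → CollinearIntersections
      to condIII α i≢j = Lᴷ.dimAtMost-1⇒collinear (condIII α _ _ i≢j)
      from : CollinearIntersections → CondIII r U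
      from collinear α i j i≢j = Lᴷ.collinear⇒dimAtMost-1 zero?
        (searchable-L (λ x → (U? i x ×-dec scaleSet? (U? j) α x) ×-dec ¬? (zero? x)))
        (collinear α i≢j)

    condII⇔collinear : CondII r U ⇔ CollinearIntersections
    condII⇔collinear = mk⇔ to from
      where
      to : CondII r U → CollinearIntersections
      to condII α i≢j = quotients-in-Fq⇒collinear (λ {x} → Equivalence.to (condII _ _ i≢j x)) α
      from : CollinearIntersections → CondII r U
      from collinear i j i≢j x = mk⇔
        (collinear⇒quotients-in-Fq (λ α → collinear α i≢j))
        (λ Fqx → Fq⊆quotSet (U-sub i) (nonzero-element i) Fqx , Fq⊆quotSet (U-sub j) (nonzero-element j) Fqx)

    scaled-axis∈prodSet : ∀ {i x} → U i x → prodSet U (map (x *_) (e i))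
    scaled-axis∈prodSet {i} {x} Uᵢx j with i Fin.≟ j
    ... | yes refl = subst (U i) (sym (lookup-scaled-e-diagonal i x)) Uᵢx
    ... | no i≢j   = subst (U j) (sym (span-e-off (x , refl) i≢j)) (proj₁ (U-sub j))

    axis-hasDim : ∀ i → HasDim (Lrsp r) (prodSet U ∩ span (e i)) (k i)
    axis-hasDim i = LinearCombination.hasDim-map Lsp {S′ = Lrsp r} (λ x → map (x *_) (e i))
      (λ c b → lincomb-map-* c b (e i))
      (λ xeᵢ≡𝟎 → trans (sym (lookup-scaled-e-diagonal i _)) (trans (cong (λ w → lookup w i) xeᵢ≡𝟎) (lookup-replicate i 0#)))
      (λ Uᵢx → scaled-axis∈prodSet Uᵢx , _ , refl)
      (λ (Uy , μ , y≡) → μ , subst (U i) (trans (cong (λ w → lookup w i) y≡) (lookup-scaled-e-diagonal i μ)) (Uy i) , y≡)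
      (bases i)

    collinear⇒collinear-span : CollinearIntersections → ∀ v {i j} → i ≢ j → lookup v i ≢ 0# → lookup v j ≢ 0# →
                               Collinear (Lrsp r) (prodSet U ∩ span v)
    collinear⇒collinear-span collinear v {i} {j} i≢j vᵢ≢0 vⱼ≢0 {x} {y} (Ux , μ , x≡) (Uy , μ′ , y≡) x≢𝟎 =
      a , (begin
        y                            ≡⟨ y≡ ⟩
        map (μ′ *_) v                ≡⟨ cong (λ c → map (c *_) v) μ′≡aμ ⟩
        map ((ι a * μ) *_) v         ≡⟨ sym (map-*-∘ (ι a) μ v) ⟩
        map (ι a *_) (map (μ *_) v)  ≡⟨ cong (map (ι a *_)) (sym x≡) ⟩
        map (ι a *_) x               ∎)
      where
      α = lookup v i / lookup v j
      coordinate : ∀ {ν} → prodSet U (map (ν *_) v) → (U i ∩ scaleSet α (U j)) (ν * lookup v i)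
      coordinate {ν} Uνv =
        subst (U i) (lookup-map i (ν *_) v) (Uνv i) ,
        ν * lookup v j , subst (U j) (lookup-map j (ν *_) v) (Uνv j) ,
        (begin
          ν * lookup v i        ≡⟨ cong (ν *_) (sym (/*-cancel vⱼ≢0)) ⟩
          ν * (α * lookup v j)  ≡⟨ x∙yz≈y∙xz ν α (lookup v j) ⟩
          α * (ν * lookup v j)  ∎)
      μ≢0 : μ ≢ 0#
      μ≢0 μ≡0 = x≢𝟎 (trans x≡ (trans (map-cong (λ z → trans (cong (_* z) μ≡0) (zeroˡ z)) v) (map-const v 0#)))
      μ′vᵢ≡ : ∃[ a ] μ′ * lookup v i ≡ ι a * (μ * lookup v i)
      μ′vᵢ≡ = collinear α i≢j (coordinate (subst (prodSet U) x≡ Ux)) (coordinate (subst (prodSet U) y≡ Uy))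
                (*-nonzero μ≢0 vᵢ≢0)
      a = proj₁ μ′vᵢ≡
      μ′≡aμ : μ′ ≡ ι a * μ
      μ′≡aμ = *-cancelʳ vᵢ≢0 (trans (proj₂ μ′vᵢ≡) (sym (*-assoc (ι a) μ (lookup v i))))

    collinear⇒collinear-nonaxial : CollinearIntersections → ∀ v → ¬ (∃[ i ] span v ≐ span (e i)) →
                                   Collinear (Lrsp r) (prodSet U ∩ span v)
    collinear⇒collinear-nonaxial collinear v not-axis with 𝟎-or-axis-or-two-nonzero v
    ... | inj₁ v≡𝟎 = λ (_ , x∈⟨v⟩) _ x≢𝟎 → contradiction (span-𝟎 (subst (λ w → span w _) v≡𝟎 x∈⟨v⟩)) x≢𝟎
    ... | inj₂ (inj₁ axis) = contradiction axis not-axis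
    ... | inj₂ (inj₂ (i , j , i≢j , vᵢ≢0 , vⱼ≢0)) = collinear⇒collinear-span collinear v i≢j vᵢ≢0 vⱼ≢0

    collinear⇒condI : CollinearIntersections → CondI r U k
    collinear⇒condI collinear = condIa , λ i → axis-hasDim i , k≥2 i
      where
      condIa : ∀ v → ¬ (∃[ i ] span v ≐ span (e i)) → DimAtMost (Lrsp r) (prodSet U ∩ span v) 1
      condIa v not-axis = Lʳᴷ.collinear⇒dimAtMost-1 r (λ x → x ≟ᵛ replicate r 0#)
        (searchable-Vec searchable-L (λ x → (prodSet? x ×-dec span? v x) ×-dec ¬? (x ≟ᵛ replicate r 0#)))
        (collinear⇒collinear-nonaxial collinear v not-axis)

    scaled-e+βe∈prodSet : ∀ {i j β x} → i ≢ j → U i x → U j (x * β) → prodSet U (map (x *_) (e+βe i β j))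
    scaled-e+βe∈prodSet {i} {j} {β} {x} i≢j Uᵢx Uⱼxβ m with i Fin.≟ m | j Fin.≟ m
    ... | yes refl | _    = subst (U i) (sym (trans (lookup-map i (x *_) (e+βe i β j))
                              (trans (cong (x *_) (e+βe-at-i i≢j β)) (*-identityʳ x)))) Uᵢx
    ... | no _ | yes refl = subst (U j) (sym (trans (lookup-map j (x *_) (e+βe i β j)) (cong (x *_) (e+βe-at-j i≢j β)))) Uⱼxβ
    ... | no i≢m | no j≢m = subst (U m) (sym (trans (lookup-map m (x *_) (e+βe i β j))
                              (trans (cong (x *_) (e+βe-elsewhere i≢j β i≢m j≢m)) (zeroʳ x)))) (proj₁ (U-sub m))

    condI⇒collinear : CondI r U k → CollinearIntersections
    condI⇒collinear (condIa , _) α {i} {j} i≢j with zero? α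
    ... | yes α≡0 = λ (_ , u , _ , x≡αu) _ x≢0 → contradiction (trans x≡αu (trans (cong (_* u) α≡0) (zeroˡ u))) x≢0
    ... | no α≢0  = collinear
      where
      v = e+βe i (α ⁻¹) j
      coordinate-i : ∀ x → lookup (map (x *_) v) i ≡ x
      coordinate-i x = trans (lookup-map i (x *_) v) (trans (cong (x *_) (e+βe-at-i i≢j (α ⁻¹))) (*-identityʳ x))
      scaled-v∈prodSet : ∀ {x} → (U i ∩ scaleSet α (U j)) x → prodSet U (map (x *_) v)
      scaled-v∈prodSet {x} (Uᵢx , u , Uⱼu , x≡αu) = scaled-e+βe∈prodSet i≢j Uᵢx
        (subst (U j) (sym (trans (cong (_/ α) (trans x≡αu (*-comm α u))) (*/-cancel α≢0))) Uⱼu)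
      collinear : Collinear Lsp (U i ∩ scaleSet α (U j))
      collinear {x} {y} Wx Wy x≢0 =
        let xv≢𝟎 = λ xv≡𝟎 → x≢0 (trans (sym (coordinate-i x)) (trans (cong (λ w → lookup w i) xv≡𝟎) (lookup-replicate i 0#)))
            (a , yv≡axv) = Lʳᴷ.dimAtMost-1⇒collinear r (condIa v (e+βe-nonaxial i≢j (⁻¹-nonzero α≢0)))
                             (scaled-v∈prodSet Wx , x , refl) (scaled-v∈prodSet Wy , y , refl) xv≢𝟎
        in a , (begin
          y                                      ≡⟨ sym (coordinate-i y) ⟩
          lookup (map (y *_) v) i                ≡⟨ cong (λ w → lookup w i) yv≡axv ⟩
          lookup (map (ι a *_) (map (x *_) v)) i ≡⟨ lookup-map i (ι a *_) (map (x *_) v) ⟩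
          ι a * lookup (map (x *_) v) i          ≡⟨ cong (ι a *_) (coordinate-i x) ⟩
          ι a * x                                ∎)

theorem3p6 : (q n r : ℕ) → IsPrimePower q → 1 ≤ n → 1 ≤ r
    → (K L : Field) (ι : Field.Carrier K → Field.Carrier L) → IsFieldHom K L ι
    → Fin q ↔ Field.Carrier K
    → HasDim (Ext.Lsp K L ι) (λ _ → ⊤) n
    → (U : Fin r → Field.Carrier L → Set)
    → (∀ i → IsSubspace (Ext.Lsp K L ι) (U i))
    → (k : Fin r → ℕ)
    → (∀ i → HasDim (Ext.Lsp K L ι) (U i) (k i))
    → (∀ i → 2 ≤ k i)
    → (Ext.CondI K L ι r U k ⇔ Ext.CondII K L ι r U)
      × (Ext.CondII K L ι r U ⇔ Ext.CondIII K L ι r U)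
theorem3p6 _ _ _ _ _ _ K L ι hom finite basis U U-sub _ bases k≥2 =
  mk⇔ (from condII⇔collinear ∘ condI⇒collinear) (collinear⇒condI ∘ to condII⇔collinear) ,
  mk⇔ (from condIII⇔collinear ∘ to condII⇔collinear) (from condII⇔collinear ∘ to condIII⇔collinear)
  where
  open FiniteExtension K L ι hom finite basis
  open Conditions U U-sub bases k≥2
  open Equivalence
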